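{- If $G$ is a generalized prism of a cycle, then $\chi_{\rho}(S(G))\le 5$.
   Context: A generalized prism of a cycle is a cubic graph obtained from the disjoint union of two cycles of the same length $n\ge3$ by adding a perfect matching between the vertex sets of the two cycles. For a positive integer $i$, an $i$-packing in a graph $H$ is a set of vertices any two distinct of which are at distance greater than $i$ in $H$. The packing chromatic number $\chi_{\rho}(H)$ is the smallest $k$ such that $V(H)$ can be partitioned into sets $\Pi_1,\ldots,\Pi_k$ with $\Pi_i$ an $i$-packing for each $i\in[k]$. $S(G)$ is the subdivision of $G$: the graph obtained by inserting one new vertex on each edge of $G$. -}

module Defs where

open import Data.Nat using (ℕ; zero; suc; _<_; NonZero)
open import Data.Nat.DivMod using (_mod_)
open import Data.Fin using (Fin; toℕ)
open import Data.Fin.Permutation using (Permutation′; _⟨$⟩ʳ_)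
open import Data.Bool using (Bool; true; false)
open import Data.Product using (Σ; _×_; _,_; proj₁; proj₂)
open import Data.Sum using (_⊎_; inj₁; inj₂)
open import Data.Empty using (⊥)
open import Relation.Binary.PropositionalEquality using (_≡_; _≢_)

record Graph : Set₁ where
  field
    V    : Set
    E    : Set
    ends : E → V × V

open Graph public

Incident : (G : Graph) → V G → E G → Set
Incident G v e = (v ≡ proj₁ (ends G e)) ⊎ (v ≡ proj₂ (ends G e))

-- Subdivision S(G): vertices are V ⊎ E, and v ~ e iff v is an end of e.
SV : Graph → Set
SV G = V G ⊎ E G

SAdj : (G : Graph) → SV G → SV G → Set
SAdj G (inj₁ v) (inj₂ e) = Incident G v e
SAdj G (inj₂ e) (inj₁ v) = Incident G v e
SAdj G (inj₁ _) (inj₁ _) = ⊥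
SAdj G (inj₂ _) (inj₂ _) = ⊥

data Walk {A : Set} (R : A → A → Set) : ℕ → A → A → Set where
  here : ∀ {a} → Walk R 0 a a
  step : ∀ {k a b c} → R a b → Walk R k b c → Walk R (suc k) a c

DistGt : {A : Set} → (A → A → Set) → A → A → ℕ → Set
DistGt R a b i = ∀ d → Walk R d a b → i < d

-- A packing colouring with colours 1..k: colour c : Fin k stands for class toℕ c + 1,
-- and each class Π_i is an i-packing.
PackingColoring : {A : Set} → (A → A → Set) → (k : ℕ) → (A → Fin k) → Set
PackingColoring {A} R k c =
  ∀ (a b : A) → a ≢ b → c a ≡ c b → DistGt R a b (suc (toℕ (c a)))

PackChromLe : {A : Set} → (A → A → Set) → ℕ → Set
PackChromLe {A} R k = Σ (A → Fin k) (PackingColoring R k)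

next : ∀ {n} .{{_ : NonZero n}} → Fin n → Fin n
next {n} i = suc (toℕ i) mod n

PrismEdge : ℕ → Set
PrismEdge n = (Bool × Fin n) ⊎ Fin n

GenPrism : (n : ℕ) .{{_ : NonZero n}} → Permutation′ n → Graph
GenPrism n σ = record
  { V = Bool × Fin n
  ; E = PrismEdge n
  ; ends = λ { (inj₁ (b , i)) → (b , i) , (b , next i)
             ; (inj₂ i) → (false , i) , (true , σ ⟨$⟩ʳ i) } }

module Submission where

-- Subdivision vertices all get class 1. Distances between original vertices double in S(G), so it
-- suffices to colour G with classes 2 and 3 properly and with classes 4 and 5 so that equal colours
-- are at distance at least 3. On the outer cycle we alternate 2 and 3, putting a single 4 at the
-- vertex k matched to inner vertex 0 when n is odd. The inner cycle is described by a cyclic word: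
-- `opp` takes whichever of classes 2 and 3 the matched outer vertex does not have, `four` and
-- `five` take classes 4 and 5; the word must not contain `opp opp` and must space out equal `four`s
-- and `five`s. Such words exist with a period of length 6, and for odd n three of them have
-- disjoint `four`s, so one avoids the two inner vertices matched to the neighbours of k. The case
-- n = 5, which includes the Petersen graph, is settled by checking explicit colourings by evaluation.

open import Defs
open import Data.Nat using (ℕ; zero; suc; _+_; _∸_; _*_; _%_; _≤_; _<_; _≤?_; z≤n; s≤s; NonZero)
open import Data.Nat.Properties
  using (+-suc; +-comm; +-assoc; +-identityʳ; ≤-trans; +-mono-≤; m≤m+n; 1+n≢n; <⇒≤; m+[n∸m]≡n; <-cmp;
         <-irrefl; m+n≡0⇒n≡0; m<n⇒0<n∸m; +-monoˡ-<; ≤-reflexive; m∸n+n≡m; ≤-<-trans; m∸n≤m;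
         m≤n⇒m<n∨m≡n; ≰⇒>)
open import Data.Nat.DivMod using (_mod_; m<n⇒m%n≡m; n%n≡0; m%n<n; m%n%n≡m%n; %-distribˡ-+; [m+n]%n≡m%n)
open import Data.Fin using (Fin; zero; suc; toℕ; fromℕ; inject₁)
open import Data.Fin.Properties
  using (0≢1+n; toℕ<n; toℕ-injective; toℕ-fromℕ<; toℕ-fromℕ; toℕ-inject₁; inject₁ℕ<)
import Data.Fin.Properties as Finₚ
open import Data.Fin.Permutation using (Permutation′; _⟨$⟩ʳ_; _⟨$⟩ˡ_; inverseˡ; inverseʳ)
open import Data.Bool using (Bool; true; false; T; _∧_; _∨_; not; if_then_else_)
import Data.Bool.Properties as Boolₚ
open import Data.Bool.ListAction using (all; any)
open import Data.Maybe using (Maybe; just; nothing; is-just)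
open import Data.Product using (Σ; ∃; ∃-syntax; _×_; _,_; proj₁; proj₂)
import Data.Product.Properties as Productₚ
open import Data.Sum using (_⊎_; inj₁; inj₂)
import Data.Sum.Properties as Sumₚ
open import Data.Empty using (⊥; ⊥-elim)
open import Data.Unit using (tt)
open import Data.Vec using (Vec; []; _∷_; lookup; tabulate; replicate)
open import Data.Vec.Properties using (lookup∘tabulate)
open import Data.List using (List; []; _∷_; _++_; length; drop; map; filter; concatMap; allFin; cartesianProduct)
open import Data.List.Properties using (length-++; ++-assoc)
open import Data.List.Membership.Propositional using (_∈_; _∉_)
open import Data.List.Membership.Propositional.Properties
  using (∈-map⁺; ∈-++⁺ˡ; ∈-++⁺ʳ; ∈-filter⁺; ∈-concatMap⁺; ∈-allFin; ∈-cartesianProduct⁺)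
open import Data.List.Relation.Unary.Any using (Any; here; there; satisfied)
import Data.List.Relation.Unary.Any as Any
open import Data.List.Relation.Unary.Any.Properties using (any⁺; any⁻)
open import Data.List.Relation.Unary.All as All using (All)
open import Data.List.Relation.Unary.All.Properties using (all⁺)
open import Function using (_∘_; case_of_)
open import Function.Bundles using (Injection)
open import Function.Properties.Inverse using (↔⇒↣)
open import Relation.Nullary using (¬_; Dec; yes; no)
open import Relation.Nullary.Decidable using (_⊎-dec_; _→-dec_; fromWitness; ⌊_⌋)
open import Relation.Binary using (DecidableEquality)
open import Relation.Binary.Definitions using (tri<; tri≈; tri>)
open import Relation.Binary.PropositionalEquality
  using (_≡_; _≢_; refl; sym; trans; cong; subst; module ≡-Reasoning)
open ≡-Reasoning

-- Lifting colourings of G to packing colourings of S(G)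

Adjacent : (G : Graph) → V G → V G → Set
Adjacent G u v = Σ (E G) λ e → Incident G u e × Incident G v e

Adjacent-sym : ∀ {G u v} → Adjacent G u v → Adjacent G v u
Adjacent-sym (e , u∈e , v∈e) = e , v∈e , u∈e

-- cᵢ is the packing class i, encoded by `toFin` as i - 1 like in `PackingColoring`.
data Colour : Set where
  c₂ c₃ c₄ c₅ : Colour

data Plain : Colour → Set where
  c₂ : Plain c₂
  c₃ : Plain c₃

data Sparse : Colour → Set where
  c₄ : Sparse c₄
  c₅ : Sparse c₅

plain-or-sparse : ∀ c → Plain c ⊎ Sparse c
plain-or-sparse c₂ = inj₁ c₂
plain-or-sparse c₃ = inj₁ c₃
plain-or-sparse c₄ = inj₂ c₄
plain-or-sparse c₅ = inj₂ c₅

plain-not-sparse : ∀ {c} → Plain c → ¬ Sparse c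
plain-not-sparse c₂ ()
plain-not-sparse c₃ ()

plain≢sparse : ∀ {c d} → Plain c → Sparse d → c ≢ d
plain≢sparse p s refl = plain-not-sparse p s

toFin : Colour → Fin 5
toFin c₂ = suc zero
toFin c₃ = suc (suc zero)
toFin c₄ = suc (suc (suc zero))
toFin c₅ = suc (suc (suc (suc zero)))

fromFin : Fin 5 → Colour
fromFin (suc (suc (suc (suc zero)))) = c₅
fromFin (suc (suc (suc zero))) = c₄
fromFin (suc (suc zero)) = c₃
fromFin _ = c₂

fromFin-toFin : ∀ c → fromFin (toFin c) ≡ c
fromFin-toFin c₂ = refl
fromFin-toFin c₃ = refl
fromFin-toFin c₄ = refl
fromFin-toFin c₅ = refl

toFin-injective : ∀ {c d} → toFin c ≡ toFin d → c ≡ d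
toFin-injective {c} {d} eq = trans (sym (fromFin-toFin c)) (trans (cong fromFin eq) (fromFin-toFin d))

toFin≢zero : ∀ c → toFin c ≢ zero
toFin≢zero c₂ ()
toFin≢zero c₃ ()
toFin≢zero c₄ ()
toFin≢zero c₅ ()

plain-class<4 : ∀ {c} → Plain c → suc (toℕ (toFin c)) < 4
plain-class<4 c₂ = s≤s (s≤s (s≤s z≤n))
plain-class<4 c₃ = s≤s (s≤s (s≤s (s≤s z≤n)))

record Liftable (G : Graph) (κ : V G → Colour) : Set where
  field
    proper : ∀ {u v} → u ≢ v → κ u ≡ κ v → ¬ Adjacent G u v
    sparse : ∀ {u v w} → u ≢ v → κ u ≡ κ v → Sparse (κ u) → Adjacent G u w → ¬ Adjacent G w v

module _ (G : Graph) where

  halve : ∀ {d u v} → Walk (SAdj G) d (inj₁ u) (inj₁ v) → ∃[ j ] d ≡ j + j × Walk (Adjacent G) j u v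
  halve here = 0 , refl , here
  halve (step {b = inj₂ e} u∈e (step {b = inj₁ w} w∈e rest)) with halve rest
  ... | j , refl , walk = suc j , cong suc (sym (+-suc j j)) , step (e , u∈e , w∈e) walk
  halve (step {b = inj₂ _} _ (step {b = inj₂ _} () _))

  liftable⇒packing : (κ : V G → Colour) → Liftable G κ → PackChromLe (SAdj G) 5
  liftable⇒packing κ liftable = colour , packing
    where
    open Liftable liftable

    colour : SV G → Fin 5
    colour (inj₁ v) = toFin (κ v)
    colour (inj₂ e) = zero

    far : ∀ {j u v} → u ≢ v → κ u ≡ κ v → Walk (Adjacent G) j u v → suc (toℕ (toFin (κ u))) < j + j
    far u≢v _ here = ⊥-elim (u≢v refl)
    far u≢v eq (step uv here) = ⊥-elim (proper u≢v eq uv)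
    far {u = u} u≢v eq (step uw (step wv here)) with plain-or-sparse (κ u)
    ... | inj₁ p = plain-class<4 p
    ... | inj₂ s = ⊥-elim (sparse u≢v eq s uw wv)
    far {j = suc (suc (suc j))} {u} _ _ (step _ (step _ (step _ _))) =
      ≤-trans (s≤s (toℕ<n (toFin (κ u)))) (+-mono-≤ (m≤m+n 3 j) (m≤m+n 3 j))

    packing : PackingColoring (SAdj G) 5 colour
    packing (inj₁ u) (inj₁ v) u≢v eq d walk with halve walk
    ... | j , refl , walk′ = far (λ { refl → u≢v refl }) (toFin-injective eq) walk′
    packing (inj₁ u) (inj₂ _) _ eq = ⊥-elim (toFin≢zero (κ u) eq)
    packing (inj₂ _) (inj₁ v) _ eq = ⊥-elim (toFin≢zero (κ v) (sym eq))
    packing (inj₂ e) (inj₂ f) e≢f _ .0 here = ⊥-elim (e≢f refl)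
    packing (inj₂ e) (inj₂ f) _ _ .(suc (suc _)) (step _ (step _ _)) = s≤s (s≤s z≤n)

module _ {m : ℕ} where

  toℕ-next : (i : Fin (suc m)) → toℕ (next i) ≡ suc (toℕ i) % suc m
  toℕ-next i = toℕ-fromℕ< (m%n<n (suc (toℕ i)) (suc m))

  next-inject₁ : (i : Fin m) → next (inject₁ i) ≡ suc i
  next-inject₁ i = toℕ-injective (begin
    toℕ (next (inject₁ i))          ≡⟨ toℕ-next (inject₁ i) ⟩
    suc (toℕ (inject₁ i)) % suc m   ≡⟨ m<n⇒m%n≡m (s≤s (inject₁ℕ< i)) ⟩
    suc (toℕ (inject₁ i))           ≡⟨ cong suc (toℕ-inject₁ i) ⟩
    suc (toℕ i)                     ∎)

  toℕ-next-inject₁ : (i : Fin m) → toℕ (next (inject₁ i)) ≡ suc (toℕ (inject₁ i))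
  toℕ-next-inject₁ i = trans (cong toℕ (next-inject₁ i)) (cong suc (sym (toℕ-inject₁ i)))

  next-fromℕ : next (fromℕ m) ≡ zero
  next-fromℕ = toℕ-injective (trans (toℕ-next (fromℕ m))
                 (trans (cong (λ x → suc x % suc m) (toℕ-fromℕ m)) (n%n≡0 (suc m))))

  prev : Fin (suc m) → Fin (suc m)
  prev zero = fromℕ m
  prev (suc i) = inject₁ i

  next-prev : (i : Fin (suc m)) → next (prev i) ≡ i
  next-prev zero = next-fromℕ
  next-prev (suc i) = next-inject₁ i

  data CyclicView : Fin (suc m) → Set where
    final : CyclicView (fromℕ m)
    inner : (i : Fin m) → CyclicView (inject₁ i)

cyclicView : ∀ {m} (i : Fin (suc m)) → CyclicView i
cyclicView {zero} zero = final
cyclicView {suc m} zero = inner zero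
cyclicView {suc m} (suc i) with cyclicView i
... | final = final
... | inner j = inner (suc j)

module _ {m : ℕ} where

  next-injective : {i j : Fin (suc m)} → next i ≡ next j → i ≡ j
  next-injective {i} {j} eq with cyclicView i | cyclicView j
  ... | final | final = refl
  ... | final | inner j′ = ⊥-elim (0≢1+n (trans (sym next-fromℕ) (trans eq (next-inject₁ j′))))
  ... | inner i′ | final = ⊥-elim (0≢1+n (trans (sym next-fromℕ) (trans (sym eq) (next-inject₁ i′))))
  ... | inner i′ | inner j′ =
    cong inject₁ (Finₚ.suc-injective (trans (sym (next-inject₁ i′)) (trans eq (next-inject₁ j′))))

  prev-next : (i : Fin (suc m)) → prev (next i) ≡ i
  prev-next i = next-injective (next-prev (next i))

  next≡zero⇒fromℕ : {i : Fin (suc m)} → next i ≡ zero → i ≡ fromℕ m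
  next≡zero⇒fromℕ eq = next-injective (trans eq (sym next-fromℕ))

fromℕ≢zero : ∀ {m} → 1 ≤ m → fromℕ m ≢ zero
fromℕ≢zero (s≤s _) ()

next-zero≢zero : ∀ {m} → 1 ≤ m → next {suc m} zero ≢ zero
next-zero≢zero (s≤s _) eq = 0≢1+n (trans (sym eq) (next-inject₁ zero))

toℕ-next-zero : ∀ {m} → 1 ≤ m → toℕ (next {suc m} zero) ≡ 1
toℕ-next-zero (s≤s {n = m} _) = cong toℕ (next-inject₁ {suc m} zero)

next≢id : ∀ {m} → 1 ≤ m → (i : Fin (suc m)) → next i ≢ i
next≢id 1≤m i eq with cyclicView i
... | final = fromℕ≢zero 1≤m (sym (trans (sym next-fromℕ) eq))
... | inner j = 1+n≢n (trans (sym (cong toℕ (next-inject₁ j))) (trans (cong toℕ eq) (toℕ-inject₁ j)))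

-- Colouring a generalized prism from an outer colouring and an inner word

-- Letters of the inner word: `opp` is coloured opposite to the matched outer vertex, `four` and
-- `five` get c₄ and c₅, and `anchor` (only at inner vertex 0, matched with the outer c₄ vertex k)
-- is coloured like `opp` but may have an `opp` neighbour.
data Letter : Set where
  opp four five anchor : Letter

data Wide : Letter → Set where
  four : Wide four
  five : Wide five

module _ {m : ℕ} where

  record OuterColouring (φ : Fin (suc m) → Colour) (k : Fin (suc m)) : Set where
    field
      φ-proper : ∀ i → φ i ≢ φ (next i)
      φ≢c₅     : ∀ i → φ i ≢ c₅
      φ≡c₄⇒k   : ∀ i → φ i ≡ c₄ → i ≡ k

  record CyclicWord (w : Fin (suc m) → Letter) : Set where
    field
      opp-gap       : ∀ j → w j ≡ opp → w (next j) ≢ opp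
      wide-gap₁     : ∀ j → Wide (w j) → w (next j) ≢ w j
      wide-gap₂     : ∀ j → Wide (w j) → w (next (next j)) ≢ w j
      anchor⇒zero   : ∀ j → w j ≡ anchor → j ≡ zero
      anchor-next   : w zero ≡ anchor → w (next zero) ≢ four
      anchor-prev   : w zero ≡ anchor → w (fromℕ m) ≢ four
      anchor-flanks : w zero ≡ anchor → w (fromℕ m) ≡ opp → w (next zero) ≢ opp

module PrismColouring (m : ℕ) (σ : Permutation′ (suc m)) where

  Vertex : Set
  Vertex = Bool × Fin (suc m)

  private
    P = GenPrism (suc m) σ

  s s⁻¹ : Fin (suc m) → Fin (suc m)
  s = σ ⟨$⟩ʳ_
  s⁻¹ = σ ⟨$⟩ˡ_

  data Step : Vertex → Vertex → Set where
    stay    : ∀ {u} → Step u u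
    forward : ∀ {b i j} → j ≡ next i → Step (b , i) (b , j)
    back    : ∀ {b i j} → i ≡ next j → Step (b , i) (b , j)
    rung    : ∀ {i j} → j ≡ s i → Step (false , i) (true , j)
    rung⁻¹  : ∀ {i j} → i ≡ s j → Step (true , i) (false , j)

  Adjacent⇒Step : ∀ {u v} → Adjacent P u v → Step u v
  Adjacent⇒Step (inj₁ _ , inj₁ refl , inj₁ refl) = stay
  Adjacent⇒Step (inj₁ _ , inj₁ refl , inj₂ refl) = forward refl
  Adjacent⇒Step (inj₁ _ , inj₂ refl , inj₁ refl) = back refl
  Adjacent⇒Step (inj₁ _ , inj₂ refl , inj₂ refl) = stay
  Adjacent⇒Step (inj₂ _ , inj₁ refl , inj₁ refl) = stay
  Adjacent⇒Step (inj₂ _ , inj₁ refl , inj₂ refl) = rung refl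
  Adjacent⇒Step (inj₂ _ , inj₂ refl , inj₁ refl) = rung⁻¹ refl
  Adjacent⇒Step (inj₂ _ , inj₂ refl , inj₂ refl) = stay

  record Compatible (φ : Fin (suc m) → Colour) (w : Fin (suc m) → Letter) (k : Fin (suc m)) : Set where
    field
      σk≡zero   : s k ≡ zero
      anchor⇒c₄ : w zero ≡ anchor → φ k ≡ c₄
      c₄⇒anchor : φ k ≡ c₄ → w zero ≡ anchor
      c₄-next   : φ k ≡ c₄ → w (s (next k)) ≢ four
      c₄-prev   : φ k ≡ c₄ → w (s (prev k)) ≢ four

  module Construction (1≤m : 1 ≤ m) {φ w k} (O : OuterColouring φ k) (W : CyclicWord w) (C : Compatible φ w k)
                      where
    open OuterColouring O
    open CyclicWord W
    open Compatible C

    s⁻¹≢k : ∀ {j} → j ≢ zero → s⁻¹ j ≢ k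
    s⁻¹≢k j≢0 eq = j≢0 (trans (sym (inverseʳ σ)) (trans (cong s eq) σk≡zero))

    s⁻¹-zero : s⁻¹ zero ≡ k
    s⁻¹-zero = trans (cong s⁻¹ (sym σk≡zero)) (inverseˡ σ)

    φ-plain : ∀ {i} → i ≢ k → Plain (φ i)
    φ-plain {i} i≢k with φ i in eq
    ... | c₂ = c₂
    ... | c₃ = c₃
    ... | c₄ = ⊥-elim (i≢k (φ≡c₄⇒k i eq))
    ... | c₅ = ⊥-elim (φ≢c₅ i eq)

    φ-sparse⇒c₄ : ∀ {i} → Sparse (φ i) → φ i ≡ c₄
    φ-sparse⇒c₄ {i} sp with φ i in eq | sp
    ... | c₄ | _ = refl
    ... | c₅ | _ = ⊥-elim (φ≢c₅ i eq)

    φ-sparse⇒k : ∀ {i} → Sparse (φ i) → i ≡ k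
    φ-sparse⇒k {i} sp = φ≡c₄⇒k i (φ-sparse⇒c₄ sp)

    -- Since φ k = c₄, the anchor gets colour free: the colour of the outer partner of an inner
    -- neighbour carrying `opp`, whose own colour is therefore the other one of c₂ and c₃.
    freeFor : Letter → Colour
    freeFor opp = φ (s⁻¹ (next zero))
    freeFor _   = φ (s⁻¹ (fromℕ m))

    free : Colour
    free = freeFor (w (next zero))

    free-plain : Plain free
    free-plain = helper (w (next zero))
      where
      helper : ∀ l → Plain (freeFor l)
      helper opp    = φ-plain (s⁻¹≢k (next-zero≢zero 1≤m))
      helper four   = φ-plain (s⁻¹≢k (fromℕ≢zero 1≤m))
      helper five   = φ-plain (s⁻¹≢k (fromℕ≢zero 1≤m))
      helper anchor = φ-plain (s⁻¹≢k (fromℕ≢zero 1≤m))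

    opposite : Colour → Colour
    opposite c₂ = c₃
    opposite c₃ = c₂
    opposite c₄ = free
    opposite c₅ = free

    opposite-plain : ∀ c → Plain (opposite c)
    opposite-plain c₂ = c₃
    opposite-plain c₃ = c₂
    opposite-plain c₄ = free-plain
    opposite-plain c₅ = free-plain

    opposite-≢ : ∀ c → opposite c ≢ c
    opposite-≢ c₂ ()
    opposite-≢ c₃ ()
    opposite-≢ c₄ eq = plain≢sparse free-plain c₄ eq
    opposite-≢ c₅ eq = plain≢sparse free-plain c₅ eq

    innerColour : Fin (suc m) → Letter → Colour
    innerColour j opp    = opposite (φ (s⁻¹ j))
    innerColour j anchor = opposite (φ (s⁻¹ j))
    innerColour j four   = c₄
    innerColour j five   = c₅

    κ : Vertex → Colour
    κ (false , i) = φ i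
    κ (true , j)  = innerColour j (w j)

    innerColour-plain : ∀ {j l} → Plain (innerColour j l) → l ≡ opp ⊎ l ≡ anchor
    innerColour-plain {l = opp} _ = inj₁ refl
    innerColour-plain {l = anchor} _ = inj₂ refl

    opp-plain : ∀ j → Plain (innerColour j opp)
    opp-plain j = opposite-plain (φ (s⁻¹ j))

    innerColour-sparse : ∀ {j j′ l l′} → innerColour j l ≡ innerColour j′ l′ → Sparse (innerColour j l) →
                         l′ ≡ l × Wide l
    innerColour-sparse {l = four} {four} _ _ = refl , four
    innerColour-sparse {l = five} {five} _ _ = refl , five
    innerColour-sparse {j} {l = opp} _ sp = ⊥-elim (plain-not-sparse (opp-plain j) sp)
    innerColour-sparse {j} {l = anchor} _ sp = ⊥-elim (plain-not-sparse (opp-plain j) sp)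
    innerColour-sparse {j′ = j′} {four} {opp} eq _ = ⊥-elim (plain≢sparse (opp-plain j′) c₄ (sym eq))
    innerColour-sparse {j′ = j′} {four} {anchor} eq _ = ⊥-elim (plain≢sparse (opp-plain j′) c₄ (sym eq))
    innerColour-sparse {j′ = j′} {five} {opp} eq _ = ⊥-elim (plain≢sparse (opp-plain j′) c₅ (sym eq))
    innerColour-sparse {j′ = j′} {five} {anchor} eq _ = ⊥-elim (plain≢sparse (opp-plain j′) c₅ (sym eq))

    innerColour≡c₄ : ∀ {j l} → innerColour j l ≡ c₄ → l ≡ four
    innerColour≡c₄ {l = four} _ = refl
    innerColour≡c₄ {j} {opp} eq = ⊥-elim (plain≢sparse (opp-plain j) c₄ eq)
    innerColour≡c₄ {j} {anchor} eq = ⊥-elim (plain≢sparse (opp-plain j) c₄ eq)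

    anchor-colour : w zero ≡ anchor → κ (true , zero) ≡ free
    anchor-colour w₀ = begin
      innerColour zero (w zero)      ≡⟨ cong (innerColour zero) w₀ ⟩
      opposite (φ (s⁻¹ zero))        ≡⟨ cong (opposite ∘ φ) s⁻¹-zero ⟩
      opposite (φ k)                 ≡⟨ cong opposite (anchor⇒c₄ w₀) ⟩
      free                           ∎

    anchor-opp : w zero ≡ anchor → w (next zero) ≡ opp → κ (true , zero) ≢ κ (true , next zero)
    anchor-opp w₀ w₁ eq = opposite-≢ (φ (s⁻¹ (next zero))) (sym (begin
      φ (s⁻¹ (next zero))                      ≡⟨ cong freeFor w₁ ⟨
      free                                     ≡⟨ anchor-colour w₀ ⟨
      κ (true , zero)                          ≡⟨ eq ⟩
      innerColour (next zero) (w (next zero))  ≡⟨ cong (innerColour (next zero)) w₁ ⟩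
      opposite (φ (s⁻¹ (next zero)))           ∎))

    opp-anchor : w (fromℕ m) ≡ opp → w zero ≡ anchor → κ (true , fromℕ m) ≢ κ (true , zero)
    opp-anchor wₘ w₀ eq = opposite-≢ (φ (s⁻¹ (fromℕ m))) (begin
      opposite (φ (s⁻¹ (fromℕ m)))             ≡⟨ cong (innerColour (fromℕ m)) wₘ ⟨
      κ (true , fromℕ m)                       ≡⟨ eq ⟩
      κ (true , zero)                          ≡⟨ anchor-colour w₀ ⟩
      freeFor (w (next zero))                  ≡⟨ not-opp (w (next zero)) (anchor-flanks w₀ wₘ) ⟩
      φ (s⁻¹ (fromℕ m))                        ∎)
      where
      not-opp : ∀ l → l ≢ opp → freeFor l ≡ φ (s⁻¹ (fromℕ m))
      not-opp opp l≢opp = ⊥-elim (l≢opp refl)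
      not-opp four _ = refl
      not-opp five _ = refl
      not-opp anchor _ = refl

    inner-proper : ∀ j → κ (true , j) ≢ κ (true , next j)
    inner-proper j eq with plain-or-sparse (κ (true , j))
    ... | inj₂ sp = let same , wide = innerColour-sparse eq sp in wide-gap₁ j wide same
    ... | inj₁ p with innerColour-plain p | innerColour-plain (subst Plain eq p)
    ...   | inj₁ wⱼ | inj₁ wⱼ′ = opp-gap j wⱼ wⱼ′
    ...   | inj₂ wⱼ | inj₂ wⱼ′ = next≢id 1≤m j (trans (anchor⇒zero _ wⱼ′) (sym (anchor⇒zero j wⱼ)))
    ...   | inj₂ wⱼ | inj₁ wⱼ′ with anchor⇒zero j wⱼ
    ...     | refl = anchor-opp wⱼ wⱼ′ eq
    inner-proper j eq | inj₁ p | inj₁ wⱼ | inj₂ wⱼ′ with next≡zero⇒fromℕ (anchor⇒zero _ wⱼ′)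
    ...     | refl = opp-anchor wⱼ (subst (λ x → w x ≡ anchor) next-fromℕ wⱼ′)
                              (subst (λ x → κ (true , fromℕ m) ≡ κ (true , x)) next-fromℕ eq)

    w-zero≢four : φ k ≡ c₄ → w zero ≢ four
    w-zero≢four φk eq with trans (sym (c₄⇒anchor φk)) eq
    ... | ()

    rung-proper : ∀ i → κ (false , i) ≢ κ (true , s i)
    rung-proper i eq with w (s i) in wₛᵢ
    ... | opp    = opposite-≢ (φ i) (sym (trans eq (cong (opposite ∘ φ) (inverseˡ σ))))
    ... | anchor = opposite-≢ (φ i) (sym (trans eq (cong (opposite ∘ φ) (inverseˡ σ))))
    ... | five   = φ≢c₅ i eq
    ... | four with φ≡c₄⇒k i eq
    ...   | refl = w-zero≢four eq (trans (cong w (sym σk≡zero)) wₛᵢ)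

    Step⇒κ≢ : ∀ {u v} → Step u v → u ≢ v → κ u ≢ κ v
    Step⇒κ≢ stay u≢v _ = u≢v refl
    Step⇒κ≢ (forward {false} refl) _ = φ-proper _
    Step⇒κ≢ (forward {true} refl) _ = inner-proper _
    Step⇒κ≢ (back {false} refl) _ = φ-proper _ ∘ sym
    Step⇒κ≢ (back {true} refl) _ = inner-proper _ ∘ sym
    Step⇒κ≢ (rung refl) _ = rung-proper _
    Step⇒κ≢ (rung⁻¹ refl) _ = rung-proper _ ∘ sym

    c₄-far-from-four : ∀ {j x} → φ k ≡ c₄ → w j ≡ four → Step (false , k) x → ¬ Step x (true , j)
    c₄-far-from-four φk wⱼ stay (rung refl) = w-zero≢four φk (trans (cong w (sym σk≡zero)) wⱼ)
    c₄-far-from-four φk wⱼ (forward refl) (rung refl) = c₄-next φk wⱼ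
    c₄-far-from-four φk wⱼ (back refl) (rung refl) =
      c₄-prev φk (subst (λ x → w (s x) ≡ four) (sym (prev-next _)) wⱼ)
    c₄-far-from-four φk wⱼ (rung refl) stay = w-zero≢four φk (trans (cong w (sym σk≡zero)) wⱼ)
    c₄-far-from-four φk wⱼ (rung refl) (forward refl) =
      anchor-next (c₄⇒anchor φk) (subst (λ x → w (next x) ≡ four) σk≡zero wⱼ)
    c₄-far-from-four φk wⱼ (rung refl) (back p) =
      anchor-prev (c₄⇒anchor φk) (subst (λ x → w x ≡ four) (next≡zero⇒fromℕ (trans (sym p) σk≡zero)) wⱼ)

    wide-far : ∀ {j j′ x} → j ≢ j′ → κ (true , j) ≡ κ (true , j′) → Wide (w j) → w j′ ≡ w j →
                Step (true , j) x → ¬ Step x (true , j′)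
    wide-far j≢j′ eq _ _ stay xv = Step⇒κ≢ xv (j≢j′ ∘ cong proj₂) eq
    wide-far j≢j′ eq _ _ ux stay = Step⇒κ≢ ux (j≢j′ ∘ cong proj₂) eq
    wide-far _ _ wide same (forward refl) (forward refl) = wide-gap₂ _ wide same
    wide-far j≢j′ _ _ _ (forward refl) (back p) = j≢j′ (next-injective p)
    wide-far j≢j′ _ _ _ (back refl) (forward q) = j≢j′ (sym q)
    wide-far _ _ wide same (back refl) (back refl) = wide-gap₂ _ (subst Wide (sym same) wide) (sym same)
    wide-far j≢j′ _ _ _ (rung⁻¹ refl) (rung q) = j≢j′ (sym q)

    liftable : Liftable P κ
    liftable = record { proper = proper ; sparse = sparse }
      where
      proper : ∀ {u v} → u ≢ v → κ u ≡ κ v → ¬ Adjacent P u v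
      proper u≢v eq uv = Step⇒κ≢ (Adjacent⇒Step uv) u≢v eq

      sparse : ∀ {u v x} → u ≢ v → κ u ≡ κ v → Sparse (κ u) → Adjacent P u x → ¬ Adjacent P x v
      sparse {false , i} {false , i′} u≢v eq sp _ _ =
        u≢v (cong (false ,_) (trans (φ-sparse⇒k sp) (sym (φ-sparse⇒k (subst Sparse eq sp)))))
      sparse {false , i} {true , j} _ eq sp ux xv with φ-sparse⇒k sp
      ... | refl =
        c₄-far-from-four φk (innerColour≡c₄ (trans (sym eq) φk)) (Adjacent⇒Step ux) (Adjacent⇒Step xv)
        where
        φk = φ-sparse⇒c₄ sp
      sparse {true , j} {false , i} u≢v eq sp ux xv =
        sparse {false , i} {true , j} (u≢v ∘ sym) (sym eq) (subst Sparse eq sp)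
               (Adjacent-sym xv) (Adjacent-sym ux)
      sparse {true , j} {true , j′} u≢v eq sp ux xv =
        let same , wide = innerColour-sparse eq sp
        in wide-far (u≢v ∘ cong (true ,_)) eq wide same (Adjacent⇒Step ux) (Adjacent⇒Step xv)

-- Colouring the outer cycle

parity : ℕ → Colour
parity zero = c₂
parity (suc zero) = c₃
parity (suc (suc x)) = parity x

parity-plain : ∀ x → Plain (parity x)
parity-plain zero = c₂
parity-plain (suc zero) = c₃
parity-plain (suc (suc x)) = parity-plain x

parity-suc : ∀ x → parity x ≢ parity (suc x)
parity-suc zero ()
parity-suc (suc zero) ()
parity-suc (suc (suc x)) = parity-suc x

parity-1+6k : ∀ k → parity (suc (k * 6)) ≡ c₃
parity-1+6k zero = refl
parity-1+6k (suc k) = parity-1+6k k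

module _ {m : ℕ} where

  evenOuter : parity m ≡ c₃ → (k : Fin (suc m)) → OuterColouring (parity ∘ toℕ) k
  evenOuter parity-m k = record
    { φ-proper = proper
    ; φ≢c₅ = λ i → plain≢sparse (parity-plain (toℕ i)) c₅
    ; φ≡c₄⇒k = λ i eq → ⊥-elim (plain≢sparse (parity-plain (toℕ i)) c₄ eq) }
    where
    proper : ∀ i → parity (toℕ i) ≢ parity (toℕ (next i))
    proper i eq with cyclicView i
    ... | final with (begin
          c₃                               ≡⟨ parity-m ⟨
          parity m                         ≡⟨ cong parity (toℕ-fromℕ m) ⟨
          parity (toℕ (fromℕ m))           ≡⟨ eq ⟩
          parity (toℕ (next (fromℕ m)))    ≡⟨ cong (parity ∘ toℕ) (next-fromℕ {m}) ⟩
          c₂                               ∎)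
    ...   | ()
    proper i eq | inner j = parity-suc (toℕ j) (begin
          parity (toℕ j)                   ≡⟨ cong parity (toℕ-inject₁ j) ⟨
          parity (toℕ (inject₁ j))         ≡⟨ eq ⟩
          parity (toℕ (next (inject₁ j)))  ≡⟨ cong (parity ∘ toℕ) (next-inject₁ j) ⟩
          parity (suc (toℕ j))             ∎)

module Offset {m : ℕ} (k : Fin (suc m)) where

  private
    N = suc m
    c = N ∸ toℕ k

    c+k≡N : toℕ k + c ≡ N
    c+k≡N = m+[n∸m]≡n (<⇒≤ (toℕ<n k))

    %-absorbˡ : ∀ x y → (x % N + y) % N ≡ (x + y) % N
    %-absorbˡ x y = begin
      (x % N + y) % N            ≡⟨ %-distribˡ-+ (x % N) y N ⟩
      (x % N % N + y % N) % N    ≡⟨ cong (λ z → (z + y % N) % N) (m%n%n≡m%n x N) ⟩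
      (x % N + y % N) % N        ≡⟨ %-distribˡ-+ x y N ⟨
      (x + y) % N                ∎

  offset : Fin (suc m) → ℕ
  offset i = (toℕ i + c) % N

  offset<n : ∀ i → offset i < N
  offset<n i = m%n<n (toℕ i + c) N

  offset-k : offset k ≡ 0
  offset-k = trans (cong (_% N) c+k≡N) (n%n≡0 N)

  offset-next : ∀ i → offset (next i) ≡ suc (offset i) % N
  offset-next i = begin
    (toℕ (next i) + c) % N        ≡⟨ cong (λ x → (x + c) % N) (toℕ-next i) ⟩
    (suc (toℕ i) % N + c) % N     ≡⟨ %-absorbˡ (suc (toℕ i)) c ⟩
    suc (toℕ i + c) % N           ≡⟨ cong (_% N) (+-comm 1 (toℕ i + c)) ⟩
    (toℕ i + c + 1) % N           ≡⟨ %-absorbˡ (toℕ i + c) 1 ⟨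
    (offset i + 1) % N            ≡⟨ cong (_% N) (+-comm (offset i) 1) ⟩
    suc (offset i) % N            ∎

  offset≡0⇒k : ∀ i → offset i ≡ 0 → i ≡ k
  offset≡0⇒k i eq with <-cmp (toℕ i) (toℕ k)
  ... | tri≈ _ i≡k _ = toℕ-injective i≡k
  ... | tri< i<k _ _ = ⊥-elim (<-irrefl (sym (m+n≡0⇒n≡0 (toℕ i) i+c≡0)) (m<n⇒0<n∸m (toℕ<n k)))
    where
    i+c≡0 : toℕ i + c ≡ 0
    i+c≡0 = trans (sym (m<n⇒m%n≡m (≤-trans (+-monoˡ-< c i<k) (≤-reflexive c+k≡N)))) eq
  ... | tri> _ _ i>k = ⊥-elim (<-irrefl (sym i∸k≡0) (m<n⇒0<n∸m i>k))
    where
    i+c≡i∸k+N : toℕ i + c ≡ (toℕ i ∸ toℕ k) + N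
    i+c≡i∸k+N = begin
      toℕ i + c                         ≡⟨ cong (_+ c) (m∸n+n≡m (<⇒≤ i>k)) ⟨
      (toℕ i ∸ toℕ k) + toℕ k + c       ≡⟨ +-assoc (toℕ i ∸ toℕ k) (toℕ k) c ⟩
      (toℕ i ∸ toℕ k) + (toℕ k + c)     ≡⟨ cong ((toℕ i ∸ toℕ k) +_) c+k≡N ⟩
      (toℕ i ∸ toℕ k) + N               ∎
    i∸k≡0 : toℕ i ∸ toℕ k ≡ 0
    i∸k≡0 = begin
      toℕ i ∸ toℕ k               ≡⟨ m<n⇒m%n≡m (≤-<-trans (m∸n≤m (toℕ i) (toℕ k)) (toℕ<n i)) ⟨
      (toℕ i ∸ toℕ k) % N         ≡⟨ [m+n]%n≡m%n (toℕ i ∸ toℕ k) N ⟨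
      ((toℕ i ∸ toℕ k) + N) % N   ≡⟨ cong (_% N) i+c≡i∸k+N ⟨
      offset i                    ≡⟨ eq ⟩
      0                           ∎

ringColour : ℕ → Colour
ringColour zero = c₄
ringColour (suc x) = parity x

ringColour-suc : ∀ x → ringColour x ≢ ringColour (suc x)
ringColour-suc zero ()
ringColour-suc (suc x) = parity-suc x

ringColour≢c₅ : ∀ x → ringColour x ≢ c₅
ringColour≢c₅ zero ()
ringColour≢c₅ (suc x) = plain≢sparse (parity-plain x) c₅

ringColour≡c₄ : ∀ x → ringColour x ≡ c₄ → x ≡ 0
ringColour≡c₄ zero _ = refl
ringColour≡c₄ (suc x) eq = ⊥-elim (plain≢sparse (parity-plain x) c₄ eq)

-- Walking around the cycle from k, the colours are c₄, c₂, c₃, c₂, …; the last step back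
-- into k is fine because k alone has colour c₄.
oddOuter : ∀ {m} → 1 ≤ m → (k : Fin (suc m)) → OuterColouring (ringColour ∘ Offset.offset k) k
oddOuter {m} (s≤s _) k = record
  { φ-proper = proper
  ; φ≢c₅ = λ i → ringColour≢c₅ (offset i)
  ; φ≡c₄⇒k = λ i eq → offset≡0⇒k i (ringColour≡c₄ (offset i) eq) }
  where
  open Offset k
  proper : ∀ i → ringColour (offset i) ≢ ringColour (offset (next i))
  proper i eq with m≤n⇒m<n∨m≡n (offset<n i)
  ... | inj₁ <n = ringColour-suc (offset i) (trans eq (cong ringColour (trans (offset-next i) (m<n⇒m%n≡m <n))))
  ... | inj₂ ≡n with ringColour≡c₄ (offset i) (trans eq (cong ringColour (begin
    offset (next i)       ≡⟨ offset-next i ⟩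
    suc (offset i) % suc m ≡⟨ cong (_% suc m) ≡n ⟩
    suc m % suc m          ≡⟨ n%n≡0 (suc m) ⟩
    0                      ∎)))
  ...   | offset≡0 with trans (sym ≡n) (cong suc offset≡0)
  ...     | ()

-- Cyclic words as lists

window : Letter → Letter → Letter → Bool
window opp    opp    _      = false
window four   four   _      = false
window five   five   _      = false
window four   _      four   = false
window five   _      five   = false
window four   anchor _      = false
window _      anchor four   = false
window opp    anchor opp    = false
window _      _      _      = true

State : Set
State = Letter × Letter

scan : State → List Letter → Maybe State
scan (a , b) [] = just (a , b)
scan (a , b) (c ∷ cs) = if window a b c then scan (b , c) cs else nothing

at : List Letter → ℕ → Letter
at [] _ = opp
at (x ∷ _) zero = x
at (_ ∷ xs) (suc q) = at xs q

-- The windows of a ∷ b ∷ cs ++ a ∷ b ∷ [] are the cyclic windows of a ∷ b ∷ cs.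
Cyclic : List Letter → Set
Cyclic (a ∷ b ∷ cs) = T (is-just (scan (a , b) (cs ++ a ∷ b ∷ [])))
Cyclic _ = ⊥

window-cong : ∀ {x x′ y y′ z z′} → x ≡ x′ → y ≡ y′ → z ≡ z′ →
              T (window x y z) → T (window x′ y′ z′)
window-cong refl refl refl t = t

scan-windows : ∀ {a b cs} → T (is-just (scan (a , b) cs)) → ∀ q → suc (suc q) < length (a ∷ b ∷ cs) →
               T (window (at (a ∷ b ∷ cs) q) (at (a ∷ b ∷ cs) (suc q)) (at (a ∷ b ∷ cs) (suc (suc q))))
scan-windows {cs = []} _ _ (s≤s (s≤s ()))
scan-windows {a} {b} {c ∷ cs} ok q q< with window a b c in eq
scan-windows {a} {b} {c ∷ cs} ok zero _ | true rewrite eq = tt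
scan-windows {a} {b} {c ∷ cs} ok (suc q) (s≤s q<) | true = scan-windows ok q q<

at-++ˡ : ∀ xs ys {q} → q < length xs → at (xs ++ ys) q ≡ at xs q
at-++ˡ (x ∷ xs) ys {zero} _ = refl
at-++ˡ (x ∷ xs) ys {suc q} (s≤s q<) = at-++ˡ xs ys q<

at-++ʳ : ∀ xs ys q → at (xs ++ ys) (length xs + q) ≡ at ys q
at-++ʳ [] ys q = refl
at-++ʳ (x ∷ xs) ys q = at-++ʳ xs ys q

isAnchor : Letter → Bool
isAnchor anchor = true
isAnchor _ = false

AnchorFree : List Letter → Set
AnchorFree xs = T (all (not ∘ isAnchor) xs)

record ValidWord (m : ℕ) (l : List Letter) : Set where
  field
    length≡   : length l ≡ suc m
    cyclic    : Cyclic l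
    tail-free : AnchorFree (drop 1 l)

wordAt : ∀ {m} → List Letter → Fin (suc m) → Letter
wordAt l j = at l (toℕ j)

cyclic-windows : ∀ {m} → 1 ≤ m → ∀ l → length l ≡ suc m → Cyclic l → (j : Fin (suc m)) →
                 T (window (wordAt l j) (wordAt l (next j)) (wordAt l (next (next j))))
cyclic-windows {m} 1≤m l@(a ∷ b ∷ cs) len ok j =
  window-cong (at-here j) (at-next j) (at-next-next j)
    (scan-windows ok (toℕ j) (subst (suc (suc (toℕ j)) <_) (sym length-ext) (s≤s (s≤s (toℕ<n j)))))
  where
  ext = l ++ a ∷ b ∷ []

  length-ext : length ext ≡ suc (suc (suc m))
  length-ext = trans (length-++ l) (trans (cong (_+ 2) len) (+-comm (suc m) 2))

  <length : ∀ {x} → x < suc m → x < length l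
  <length {x} = subst (x <_) (sym len)

  final+1≡length : suc (toℕ (fromℕ m)) ≡ length l + 0
  final+1≡length = trans (cong suc (toℕ-fromℕ m)) (trans (sym len) (sym (+-identityʳ _)))

  at-here : ∀ j → at ext (toℕ j) ≡ wordAt l j
  at-here j = at-++ˡ l _ (<length (toℕ<n j))

  at-next : ∀ j → at ext (suc (toℕ j)) ≡ wordAt l (next j)
  at-next j with cyclicView j
  ... | final = begin
    at ext (suc (toℕ (fromℕ m)))   ≡⟨ cong (at ext) (final+1≡length) ⟩
    at ext (length l + 0)          ≡⟨ at-++ʳ l _ 0 ⟩
    a                              ≡⟨ cong (at l ∘ toℕ) (next-fromℕ {m}) ⟨
    wordAt l (next (fromℕ m))      ∎
  ... | inner i = begin
    at ext (suc (toℕ (inject₁ i)))        ≡⟨ at-++ˡ l _ (<length (s≤s (inject₁ℕ< i))) ⟩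
    at l (suc (toℕ (inject₁ i)))          ≡⟨ cong (at l) (toℕ-next-inject₁ i) ⟨
    wordAt l (next (inject₁ i))           ∎

  at-next-next : ∀ j → at ext (suc (suc (toℕ j))) ≡ wordAt l (next (next j))
  at-next-next j with cyclicView j
  ... | final = begin
    at ext (suc (suc (toℕ (fromℕ m))))    ≡⟨ cong (at ext ∘ suc) (final+1≡length) ⟩
    at ext (suc (length l + 0))           ≡⟨ cong (at ext) (sym (+-suc (length l) 0)) ⟩
    at ext (length l + 1)                 ≡⟨ at-++ʳ l _ 1 ⟩
    b                                     ≡⟨ cong (at l) (toℕ-next-zero {m} 1≤m) ⟨
    wordAt {m} l (next zero)              ≡⟨ cong (λ x → wordAt l (next x)) (next-fromℕ {m}) ⟨
    wordAt l (next (next (fromℕ m)))      ∎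
  ... | inner i = trans (cong (at ext ∘ suc) (sym (toℕ-next-inject₁ i))) (at-next (next (inject₁ i)))

window-opp-opp : ∀ {c} → ¬ T (window opp opp c)
window-opp-opp ()

window-repeat₁ : ∀ {a c} → Wide a → ¬ T (window a a c)
window-repeat₁ four ()
window-repeat₁ five ()

window-repeat₂ : ∀ {a b} → Wide a → ¬ T (window a b a)
window-repeat₂ {b = opp} four ()
window-repeat₂ {b = four} four ()
window-repeat₂ {b = five} four ()
window-repeat₂ {b = anchor} four ()
window-repeat₂ {b = opp} five ()
window-repeat₂ {b = four} five ()
window-repeat₂ {b = five} five ()
window-repeat₂ {b = anchor} five ()

window-anchor-four : ∀ {a} → ¬ T (window a anchor four)
window-anchor-four {opp} ()
window-anchor-four {four} ()
window-anchor-four {five} ()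
window-anchor-four {anchor} ()

window-four-anchor : ∀ {c} → ¬ T (window four anchor c)
window-four-anchor {opp} ()
window-four-anchor {four} ()
window-four-anchor {five} ()
window-four-anchor {anchor} ()

window-opp-anchor-opp : ¬ T (window opp anchor opp)
window-opp-anchor-opp ()

anchorFree-∷ : ∀ x xs → AnchorFree (x ∷ xs) → x ≢ anchor × AnchorFree xs
anchorFree-∷ opp _ free = (λ ()) , free
anchorFree-∷ four _ free = (λ ()) , free
anchorFree-∷ five _ free = (λ ()) , free

anchorFree-at : ∀ xs → AnchorFree xs → ∀ q → at xs q ≢ anchor
anchorFree-at [] _ _ ()
anchorFree-at (x ∷ xs) free zero = proj₁ (anchorFree-∷ x xs free)
anchorFree-at (x ∷ xs) free (suc q) = anchorFree-at xs (proj₂ (anchorFree-∷ x xs free)) q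

at-drop₁ : ∀ l q → at l (suc q) ≡ at (drop 1 l) q
at-drop₁ [] q = refl
at-drop₁ (x ∷ l) q = refl

validWord⇒cyclicWord : ∀ {m l} → 1 ≤ m → ValidWord m l → CyclicWord (wordAt {m} l)
validWord⇒cyclicWord {m} {l} 1≤m valid = record
  { opp-gap = λ j wⱼ wⱼ′ → window-opp-opp {w (next (next j))} (window-cong wⱼ wⱼ′ refl (windows j))
  ; wide-gap₁ = λ j wide eq → window-repeat₁ wide (window-cong refl eq refl (windows j))
  ; wide-gap₂ = λ j wide eq → window-repeat₂ wide (window-cong refl refl eq (windows j))
  ; anchor⇒zero = anchor⇒zero
  ; anchor-next = λ w₀ eq → window-anchor-four (window-cong refl w₀ eq last-window)
  ; anchor-prev = λ w₀ eq → window-four-anchor (window-cong eq w₀ refl last-window)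
  ; anchor-flanks = λ w₀ wₘ eq → window-opp-anchor-opp (window-cong wₘ w₀ eq last-window)
  }
  where
  open ValidWord valid
  w = wordAt {m} l

  windows : ∀ j → T (window (w j) (w (next j)) (w (next (next j))))
  windows = cyclic-windows 1≤m l length≡ cyclic

  last-window : T (window (w (fromℕ m)) (w zero) (w (next zero)))
  last-window = subst (λ x → T (window (w (fromℕ m)) (w x) (w (next x)))) (next-fromℕ {m})
                  (windows (fromℕ m))

  anchor⇒zero : ∀ j → w j ≡ anchor → j ≡ zero
  anchor⇒zero zero _ = refl
  anchor⇒zero (suc j) eq =
    ⊥-elim (anchorFree-at (drop 1 l) tail-free (toℕ j) (trans (sym (at-drop₁ l (toℕ j))) eq))

-- Periodic families of words

T-∧⁻ : ∀ x {y} → T (x ∧ y) → T x × T y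
T-∧⁻ true t = tt , t

T-∧⁺ : ∀ {x y} → T x → T y → T (x ∧ y)
T-∧⁺ {true} _ t = t

_==_ : Letter → Letter → Bool
opp    == opp    = true
four   == four   = true
five   == five   = true
anchor == anchor = true
_      == _      = false

==-sound : ∀ a b → T (a == b) → a ≡ b
==-sound opp opp _ = refl
==-sound four four _ = refl
==-sound five five _ = refl
==-sound anchor anchor _ = refl

returnsTo : Maybe State → State → Bool
returnsTo (just (a , b)) (a′ , b′) = (a == a′) ∧ (b == b′)
returnsTo nothing _ = false

returnsTo-sound : ∀ r s → T (returnsTo r s) → r ≡ just s
returnsTo-sound (just (a , b)) (a′ , b′) t with T-∧⁻ (a == a′) t
... | a≡ , b≡ rewrite ==-sound a a′ a≡ | ==-sound b b′ b≡ = refl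

scan-++ : ∀ {s s′} xs ys → scan s xs ≡ just s′ → scan s (xs ++ ys) ≡ scan s′ ys
scan-++ {a , b} [] ys refl = refl
scan-++ {a , b} (c ∷ xs) ys eq with window a b c
... | true = scan-++ xs ys eq

repeat : ℕ → List Letter → List Letter
repeat zero _ = []
repeat (suc k) xs = xs ++ repeat k xs

scan-repeat : ∀ {s} xs → scan s xs ≡ just s → ∀ k ys → scan s (repeat k xs ++ ys) ≡ scan s ys
scan-repeat xs loop zero ys = refl
scan-repeat {s} xs loop (suc k) ys = begin
  scan s ((xs ++ repeat k xs) ++ ys)   ≡⟨ cong (scan s) (++-assoc xs (repeat k xs) ys) ⟩
  scan s (xs ++ repeat k xs ++ ys)     ≡⟨ scan-++ xs _ loop ⟩
  scan s (repeat k xs ++ ys)           ≡⟨ scan-repeat xs loop k ys ⟩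
  scan s ys                            ∎

length-repeat : ∀ k xs → length (repeat k xs) ≡ k * length xs
length-repeat zero xs = refl
length-repeat (suc k) xs = trans (length-++ xs) (cong (length xs +_) (length-repeat k xs))

anchorFree-++ : ∀ xs {ys} → AnchorFree xs → AnchorFree ys → AnchorFree (xs ++ ys)
anchorFree-++ [] _ free = free
anchorFree-++ (x ∷ xs) xs-free ys-free with anchorFree-∷ x xs xs-free
anchorFree-++ (opp ∷ xs) xs-free ys-free | _ , rest = anchorFree-++ xs rest ys-free
anchorFree-++ (four ∷ xs) xs-free ys-free | _ , rest = anchorFree-++ xs rest ys-free
anchorFree-++ (five ∷ xs) xs-free ys-free | _ , rest = anchorFree-++ xs rest ys-free
anchorFree-++ (anchor ∷ xs) xs-free ys-free | x≢anchor , _ = ⊥-elim (x≢anchor refl)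

anchorFree-repeat : ∀ k xs → AnchorFree xs → AnchorFree (repeat k xs)
anchorFree-repeat zero xs _ = tt
anchorFree-repeat (suc k) xs free = anchorFree-++ xs free (anchorFree-repeat k xs free)

-- A cyclic word x ∷ y ∷ prefix ++ periodᵏ ++ suffix, together with the certificate (checked by
-- evaluation) that scanning it visits the state loop before and after each copy of the period.
record Periodic : Set where
  constructor periodic
  field
    first second         : Letter
    prefix period suffix : List Letter
    loop                 : State
    {enters}             : T (returnsTo (scan (first , second) prefix) loop)
    {repeats}            : T (returnsTo (scan loop period) loop)
    {closes}             : T (is-just (scan loop (suffix ++ first ∷ second ∷ [])))
    {head-free}          : AnchorFree (second ∷ prefix)
    {period-free}        : AnchorFree period
    {suffix-free}        : AnchorFree suffix

  word : ℕ → List Letter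
  word k = first ∷ second ∷ prefix ++ repeat k period ++ suffix

  size : ℕ → ℕ
  size k = suc (length prefix + length suffix) + k * length period

  length-word : ∀ k → length (word k) ≡ suc (size k)
  length-word k = cong (2 +_) (begin
    length (prefix ++ repeat k period ++ suffix)   ≡⟨ length-++ prefix ⟩
    p + length (repeat k period ++ suffix)         ≡⟨ cong (p +_) (length-++ (repeat k period)) ⟩
    p + (length (repeat k period) + s)             ≡⟨ cong (λ x → p + (x + s)) (length-repeat k period) ⟩
    p + (k * length period + s)                    ≡⟨ cong (p +_) (+-comm (k * length period) s) ⟩
    p + (s + k * length period)                    ≡⟨ +-assoc p s _ ⟨
    p + s + k * length period                      ∎)
    where
    p = length prefix
    s = length suffix

  scan-word : ∀ k → scan (first , second) ((prefix ++ repeat k period ++ suffix) ++ first ∷ second ∷ [])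
                  ≡ scan loop (suffix ++ first ∷ second ∷ [])
  scan-word k = begin
    scan (first , second) ((prefix ++ repeat k period ++ suffix) ++ first ∷ second ∷ [])
      ≡⟨ cong (scan (first , second)) (++-assoc prefix _ _) ⟩
    scan (first , second) (prefix ++ (repeat k period ++ suffix) ++ first ∷ second ∷ [])
      ≡⟨ scan-++ prefix _ (returnsTo-sound _ _ enters) ⟩
    scan loop ((repeat k period ++ suffix) ++ first ∷ second ∷ [])
      ≡⟨ cong (scan loop) (++-assoc (repeat k period) _ _) ⟩
    scan loop (repeat k period ++ suffix ++ first ∷ second ∷ [])
      ≡⟨ scan-repeat period (returnsTo-sound _ _ repeats) k _ ⟩
    scan loop (suffix ++ first ∷ second ∷ [])
      ∎

  validWord′ : ∀ k {m} → length (word k) ≡ suc m → ValidWord m (word k)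
  validWord′ k len = record
    { length≡ = len
    ; cyclic = subst (T ∘ is-just) (sym (scan-word k)) closes
    ; tail-free = anchorFree-++ (second ∷ prefix) head-free
                    (anchorFree-++ (repeat k period) (anchorFree-repeat k period period-free) suffix-free) }

  validWord : ∀ k → ValidWord (size k) (word k)
  validWord k = validWord′ k (length-word k)

isFour : Letter → Bool
isFour four = true
isFour _ = false

isFour-false : ∀ {x} → isFour x ≡ false → x ≢ four
isFour-false {four} ()
isFour-false {opp} _ ()
isFour-false {five} _ ()
isFour-false {anchor} _ ()

atMostOne : Bool → Bool → Bool → Bool
atMostOne x₀ x₁ x₂ = not (x₀ ∧ x₁) ∧ not (x₀ ∧ x₂) ∧ not (x₁ ∧ x₂)

pick : ∀ x₀ x₁ x₂ y₀ y₁ y₂ → T (atMostOne x₀ x₁ x₂) → T (atMostOne y₀ y₁ y₂) →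
       (x₀ ≡ false × y₀ ≡ false) ⊎ (x₁ ≡ false × y₁ ≡ false) ⊎ (x₂ ≡ false × y₂ ≡ false)
pick false _ _ false _ _ _ _ = inj₁ (refl , refl)
pick _ false _ _ false _ _ _ = inj₂ (inj₁ (refl , refl))
pick _ _ false _ _ false _ _ = inj₂ (inj₂ (refl , refl))
pick false true false true false true _ ()
pick false true false true true true _ ()
pick true false false false true true _ ()
pick true false false true true true _ ()

disjointFours : List Letter → List Letter → List Letter → Bool
disjointFours [] [] [] = true
disjointFours (a ∷ as) (b ∷ bs) (c ∷ cs) = atMostOne (isFour a) (isFour b) (isFour c) ∧ disjointFours as bs cs
disjointFours _ _ _ = false

disjointFours-∷ : ∀ a b c as bs cs → T (disjointFours (a ∷ as) (b ∷ bs) (c ∷ cs)) →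
                  T (atMostOne (isFour a) (isFour b) (isFour c)) × T (disjointFours as bs cs)
disjointFours-∷ a b c _ _ _ = T-∧⁻ (atMostOne (isFour a) (isFour b) (isFour c))

disjointFours-++ : ∀ as bs cs {as′ bs′ cs′} → T (disjointFours as bs cs) → T (disjointFours as′ bs′ cs′) →
                   T (disjointFours (as ++ as′) (bs ++ bs′) (cs ++ cs′))
disjointFours-++ [] [] [] _ t′ = t′
disjointFours-++ (a ∷ as) (b ∷ bs) (c ∷ cs) t t′ with disjointFours-∷ a b c as bs cs t
... | head-ok , tail-ok = T-∧⁺ head-ok (disjointFours-++ as bs cs tail-ok t′)

disjointFours-repeat : ∀ {as bs cs} → T (disjointFours as bs cs) → ∀ k →
                       T (disjointFours (repeat k as) (repeat k bs) (repeat k cs))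
disjointFours-repeat t zero = tt
disjointFours-repeat {as} {bs} {cs} t (suc k) = disjointFours-++ as bs cs t (disjointFours-repeat t k)

disjointFours-length : ∀ as bs cs → T (disjointFours as bs cs) → length bs ≡ length as × length cs ≡ length as
disjointFours-length [] [] [] _ = refl , refl
disjointFours-length (a ∷ as) (b ∷ bs) (c ∷ cs) t
  with disjointFours-length as bs cs (proj₂ (disjointFours-∷ a b c as bs cs t))
... | bs≡ , cs≡ = cong suc bs≡ , cong suc cs≡

disjointFours-at : ∀ as bs cs → T (disjointFours as bs cs) → ∀ q →
                   T (atMostOne (isFour (at as q)) (isFour (at bs q)) (isFour (at cs q)))
disjointFours-at [] [] [] _ _ = tt
disjointFours-at (a ∷ as) (b ∷ bs) (c ∷ cs) t zero = proj₁ (disjointFours-∷ a b c as bs cs t)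
disjointFours-at (a ∷ as) (b ∷ bs) (c ∷ cs) t (suc q) =
  disjointFours-at as bs cs (proj₂ (disjointFours-∷ a b c as bs cs t)) q

-- p and q will be the inner vertices matched to the two outer neighbours of the c₄ vertex.
Avoiding : ℕ → Set
Avoiding m = ∀ p q → ∃ λ l → ValidWord m l × at l 0 ≡ anchor × at l p ≢ four × at l q ≢ four

isAnchor-sound : ∀ {x} → T (isAnchor x) → x ≡ anchor
isAnchor-sound {anchor} _ = refl

-- With at most one four per position, any two positions rule out at most two of the three words.
record Triple : Set where
  constructor triple
  open Periodic
  field
    f₀ f₁ f₂    : Periodic
    {anchored₀} : T (isAnchor (first f₀))
    {anchored₁} : T (isAnchor (first f₁))
    {anchored₂} : T (isAnchor (first f₂))
    {heads}     : T (disjointFours (first f₀ ∷ second f₀ ∷ prefix f₀) (first f₁ ∷ second f₁ ∷ prefix f₁)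
                                   (first f₂ ∷ second f₂ ∷ prefix f₂))
    {periods}   : T (disjointFours (period f₀) (period f₁) (period f₂))
    {suffixes}  : T (disjointFours (suffix f₀) (suffix f₁) (suffix f₂))

  words-disjoint : ∀ k → T (disjointFours (word f₀ k) (word f₁ k) (word f₂ k))
  words-disjoint k = disjointFours-++ (first f₀ ∷ second f₀ ∷ prefix f₀) _ _ heads
                       (disjointFours-++ (repeat k (period f₀)) _ _ (disjointFours-repeat periods k) suffixes)

  avoiding : ∀ k → Avoiding (size f₀ k)
  avoiding k p q with disjointFours-length (word f₀ k) (word f₁ k) (word f₂ k) (words-disjoint k)
                    | pick _ _ _ _ _ _ (disjointFours-at (word f₀ k) (word f₁ k) (word f₂ k) (words-disjoint k) p)
                                       (disjointFours-at (word f₀ k) (word f₁ k) (word f₂ k) (words-disjoint k) q)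
  ... | _ | inj₁ (p₀ , q₀) =
    word f₀ k , validWord f₀ k , isAnchor-sound anchored₀ , isFour-false p₀ , isFour-false q₀
  ... | len₁ , _ | inj₂ (inj₁ (p₁ , q₁)) =
    word f₁ k , validWord′ f₁ k (trans len₁ (length-word f₀ k)) ,
    isAnchor-sound anchored₁ , isFour-false p₁ , isFour-false q₁
  ... | _ , len₂ | inj₂ (inj₂ (p₂ , q₂)) =
    word f₂ k , validWord′ f₂ k (trans len₂ (length-word f₀ k)) ,
    isAnchor-sound anchored₂ , isFour-false p₂ , isFour-false q₂

module _ (m : ℕ) (σ : Permutation′ (suc m)) (1≤m : 1 ≤ m) where

  open PrismColouring m σ

  private
    k : Fin (suc m)
    k = s⁻¹ zero

  evenPrism : parity m ≡ c₃ → ∀ {l} → ValidWord m l → at l 0 ≡ opp →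
              PackChromLe (SAdj (GenPrism (suc m) σ)) 5
  evenPrism parity-m {l} valid l₀≡opp = liftable⇒packing _ κ liftable
    where
    not-c₄ : parity (toℕ k) ≢ c₄
    not-c₄ = plain≢sparse (parity-plain (toℕ k)) c₄
    compatible : Compatible (parity ∘ toℕ) (wordAt l) k
    compatible = record
      { σk≡zero = inverseʳ σ
      ; anchor⇒c₄ = λ l₀≡anchor → case trans (sym l₀≡opp) l₀≡anchor of λ ()
      ; c₄⇒anchor = ⊥-elim ∘ not-c₄
      ; c₄-next = ⊥-elim ∘ not-c₄
      ; c₄-prev = ⊥-elim ∘ not-c₄ }
    open Construction 1≤m (evenOuter parity-m k) (validWord⇒cyclicWord 1≤m valid) compatible

  oddPrism : Avoiding m → PackChromLe (SAdj (GenPrism (suc m) σ)) 5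
  oddPrism avoiding with avoiding (toℕ (s (next k))) (toℕ (s (prev k)))
  ... | l , valid , l₀≡anchor , avoid-next , avoid-prev = liftable⇒packing _ κ liftable
    where
    open Offset k
    compatible : Compatible (ringColour ∘ offset) (wordAt l) k
    compatible = record
      { σk≡zero = inverseʳ σ
      ; anchor⇒c₄ = λ _ → cong ringColour offset-k
      ; c₄⇒anchor = λ _ → l₀≡anchor
      ; c₄-next = λ _ → avoid-next
      ; c₄-prev = λ _ → avoid-prev }
    open Construction 1≤m (oddOuter 1≤m k) (validWord⇒cyclicWord 1≤m valid) compatible

-- Deciding packing colourings by evaluation

module PackingCheck {A : Set} (_≟_ : DecidableEquality A) (nbrs : A → List A) where

  ball : ℕ → A → List A
  ball zero    a = a ∷ []
  ball (suc i) a = a ∷ concatMap (ball i) (nbrs a)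

  module _ {R : A → A → Set} (nbrs-complete : ∀ {a b} → R a b → b ∈ nbrs a) where

    ball-complete : ∀ {d i a b} → d ≤ i → Walk R d a b → b ∈ ball i a
    ball-complete {i = zero}  _ here = here refl
    ball-complete {i = suc i} _ here = here refl
    ball-complete {i = suc i} (s≤s d≤i) (step r w) =
      there (∈-concatMap⁺ (ball i) (Any.map (λ { refl → ball-complete d≤i w }) (nbrs-complete r)))

  module _ {k : ℕ} (c : A → Fin k) where

    separated : A → List A → A → Bool
    separated a near b = ⌊ a ≟ b ⌋ ∨ not ⌊ c a Finₚ.≟ c b ⌋ ∨ not (any (λ x → ⌊ b ≟ x ⌋) near)

    separated-sound : ∀ {a b near} → T (separated a near b) → a ≢ b → c a ≡ c b → b ∉ near
    separated-sound {a} {b} {near} t a≢b ca≡cb b∈near with a ≟ b | c a Finₚ.≟ c b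
    ... | yes a≡b | _ = a≢b a≡b
    ... | no _ | no ca≢cb = ca≢cb ca≡cb
    ... | no _ | yes _ = T-not (any⁺ _ (Any.map (λ { refl → fromWitness {a? = b ≟ b} refl }) b∈near)) t
      where
      T-not : ∀ {x} → T x → ¬ T (not x)
      T-not {true} _ ()

    -- Opaque so that type checking never unfolds it on symbolic arguments, which is very slow;
    -- only `all-admit` below evaluates it.
    opaque
      checked : List A → Bool
      checked as = all (λ a → all (separated a (ball (suc (toℕ (c a))) a)) as) as

    opaque
     unfolding checked
     checked⇒packing : ∀ {R as} → (∀ {a b} → R a b → b ∈ nbrs a) → (∀ a → a ∈ as) → T (checked as) →
                      PackingColoring R k c
     checked⇒packing {as = as} nbrs-complete every chk a b a≢b ca≡cb d walk with d ≤? suc (toℕ (c a))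
     ... | no d≰ = ≰⇒> d≰
     ... | yes d≤ = ⊥-elim (separated-sound sep a≢b ca≡cb (ball-complete nbrs-complete d≤ walk))
       where
       sep : T (separated a (ball (suc (toℕ (c a))) a) b)
       sep = All.lookup (all⁺ _ as (All.lookup (all⁺ _ as chk) (every a))) (every b)

module SubdivisionNeighbours (G : Graph) (_≟_ : DecidableEquality (V G))
                             (edges : List (E G)) (edges-complete : ∀ e → e ∈ edges) where

  incident? : ∀ v e → Dec (Incident G v e)
  incident? v e = (v ≟ proj₁ (ends G e)) ⊎-dec (v ≟ proj₂ (ends G e))

  nbrs : SV G → List (SV G)
  nbrs (inj₁ v) = map inj₂ (filter (incident? v) edges)
  nbrs (inj₂ e) = inj₁ (proj₁ (ends G e)) ∷ inj₁ (proj₂ (ends G e)) ∷ []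

  nbrs-complete : ∀ {a b} → SAdj G a b → b ∈ nbrs a
  nbrs-complete {inj₁ v} {inj₂ e} v∈e = ∈-map⁺ inj₂ (∈-filter⁺ (incident? v) (edges-complete e) v∈e)
  nbrs-complete {inj₂ e} {inj₁ v} (inj₁ refl) = here refl
  nbrs-complete {inj₂ e} {inj₁ v} (inj₂ refl) = there (here refl)

-- Five vertices per cycle

-- GenPrism with the matching given by a function, so that it computes for a tabulated σ.
PrismOn : (n : ℕ) .{{_ : NonZero n}} → (Fin n → Fin n) → Graph
PrismOn n f = record
  { V = Bool × Fin n
  ; E = PrismEdge n
  ; ends = λ { (inj₁ (b , i)) → (b , i) , (b , next i)
             ; (inj₂ i) → (false , i) , (true , f i) } }

module _ {n : ℕ} .{{_ : NonZero n}} {σ : Permutation′ n} {f : Fin n → Fin n}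
         (f≗σ : ∀ i → f i ≡ σ ⟨$⟩ʳ i) where

  GenPrism⊆PrismOn : ∀ {a b} → SAdj (GenPrism n σ) a b → SAdj (PrismOn n f) a b
  GenPrism⊆PrismOn {inj₁ v} {inj₂ (inj₁ _)} v∈e = v∈e
  GenPrism⊆PrismOn {inj₁ v} {inj₂ (inj₂ i)} (inj₁ v≡) = inj₁ v≡
  GenPrism⊆PrismOn {inj₁ v} {inj₂ (inj₂ i)} (inj₂ v≡) = inj₂ (trans v≡ (cong (true ,_) (sym (f≗σ i))))
  GenPrism⊆PrismOn {inj₂ (inj₁ _)} {inj₁ v} v∈e = v∈e
  GenPrism⊆PrismOn {inj₂ (inj₂ i)} {inj₁ v} (inj₁ v≡) = inj₁ v≡
  GenPrism⊆PrismOn {inj₂ (inj₂ i)} {inj₁ v} (inj₂ v≡) = inj₂ (trans v≡ (cong (true ,_) (sym (f≗σ i))))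

Vertex₅ : Set
Vertex₅ = Bool × Fin 5

Edge₅ : Set
Edge₅ = PrismEdge 5

_≟V_ : DecidableEquality Vertex₅
_≟V_ = Productₚ.≡-dec Boolₚ._≟_ Finₚ._≟_

_≟S_ : DecidableEquality (Vertex₅ ⊎ Edge₅)
_≟S_ = Sumₚ.≡-dec _≟V_ (Sumₚ.≡-dec _≟V_ Finₚ._≟_)

vertices₅ : List Vertex₅
vertices₅ = cartesianProduct (false ∷ true ∷ []) (allFin 5)

vertices₅-complete : ∀ v → v ∈ vertices₅
vertices₅-complete (b , i) = ∈-cartesianProduct⁺ (bool∈ b) (∈-allFin i)
  where
  bool∈ : ∀ b → b ∈ false ∷ true ∷ []
  bool∈ false = here refl
  bool∈ true = there (here refl)

edges₅ : List Edge₅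
edges₅ = map inj₁ vertices₅ ++ map inj₂ (allFin 5)

edges₅-complete : ∀ e → e ∈ edges₅
edges₅-complete (inj₁ v) = ∈-++⁺ˡ (∈-map⁺ inj₁ (vertices₅-complete v))
edges₅-complete (inj₂ i) = ∈-++⁺ʳ (map inj₁ vertices₅) (∈-map⁺ inj₂ (∈-allFin i))

points₅ : List (Vertex₅ ⊎ Edge₅)
points₅ = map inj₁ vertices₅ ++ map inj₂ edges₅

points₅-complete : ∀ a → a ∈ points₅
points₅-complete (inj₁ v) = ∈-++⁺ˡ (∈-map⁺ inj₁ (vertices₅-complete v))
points₅-complete (inj₂ e) = ∈-++⁺ʳ (map inj₁ vertices₅) (∈-map⁺ inj₂ (edges₅-complete e))

module Prism₅ (f : Fin 5 → Fin 5) = SubdivisionNeighbours (PrismOn 5 f) _≟V_ edges₅ edges₅-complete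

-- A digit d stands for the packing class d + 1.
colouring : (outer inner outerEdges innerEdges rungs : Vec ℕ 5) → Vertex₅ ⊎ Edge₅ → Fin 5
colouring o i oe ie r (inj₁ (false , x)) = lookup o x mod 5
colouring o i oe ie r (inj₁ (true , x)) = lookup i x mod 5
colouring o i oe ie r (inj₂ (inj₁ (false , x))) = lookup oe x mod 5
colouring o i oe ie r (inj₂ (inj₁ (true , x))) = lookup ie x mod 5
colouring o i oe ie r (inj₂ (inj₂ x)) = lookup r x mod 5

onVertices : (outer inner : Vec ℕ 5) → Vertex₅ ⊎ Edge₅ → Fin 5
onVertices o i = colouring o i (replicate 5 0) (replicate 5 0) (replicate 5 0)

-- Found by computer search. The first eleven leave all subdivision vertices in class 1; the
-- other ten are for the ten permutations under which the prism is the Petersen graph.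
candidates : List (Vertex₅ ⊎ Edge₅ → Fin 5)
candidates =
  onVertices (4 ∷ 1 ∷ 2 ∷ 1 ∷ 2 ∷ []) (1 ∷ 2 ∷ 1 ∷ 3 ∷ 2 ∷ []) ∷
  onVertices (1 ∷ 3 ∷ 2 ∷ 1 ∷ 2 ∷ []) (2 ∷ 1 ∷ 4 ∷ 2 ∷ 1 ∷ []) ∷
  onVertices (4 ∷ 2 ∷ 1 ∷ 2 ∷ 1 ∷ []) (3 ∷ 2 ∷ 1 ∷ 2 ∷ 1 ∷ []) ∷
  onVertices (1 ∷ 2 ∷ 1 ∷ 4 ∷ 2 ∷ []) (1 ∷ 2 ∷ 1 ∷ 3 ∷ 2 ∷ []) ∷
  onVertices (1 ∷ 2 ∷ 1 ∷ 4 ∷ 2 ∷ []) (3 ∷ 1 ∷ 2 ∷ 1 ∷ 2 ∷ []) ∷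
  onVertices (2 ∷ 1 ∷ 3 ∷ 2 ∷ 1 ∷ []) (4 ∷ 1 ∷ 2 ∷ 1 ∷ 2 ∷ []) ∷
  onVertices (1 ∷ 2 ∷ 1 ∷ 3 ∷ 2 ∷ []) (2 ∷ 1 ∷ 2 ∷ 4 ∷ 1 ∷ []) ∷
  onVertices (1 ∷ 2 ∷ 4 ∷ 1 ∷ 2 ∷ []) (1 ∷ 2 ∷ 3 ∷ 1 ∷ 2 ∷ []) ∷
  onVertices (2 ∷ 4 ∷ 1 ∷ 2 ∷ 1 ∷ []) (1 ∷ 3 ∷ 2 ∷ 1 ∷ 2 ∷ []) ∷
  onVertices (1 ∷ 2 ∷ 4 ∷ 1 ∷ 2 ∷ []) (4 ∷ 1 ∷ 2 ∷ 1 ∷ 2 ∷ []) ∷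
  onVertices (2 ∷ 1 ∷ 2 ∷ 4 ∷ 3 ∷ []) (4 ∷ 1 ∷ 2 ∷ 1 ∷ 2 ∷ []) ∷
  colouring (2 ∷ 1 ∷ 3 ∷ 0 ∷ 0 ∷ []) (0 ∷ 0 ∷ 0 ∷ 0 ∷ 1 ∷ []) (0 ∷ 0 ∷ 1 ∷ 4 ∷ 1 ∷ []) (1 ∷ 2 ∷ 1 ∷ 4 ∷ 3 ∷ []) (0 ∷ 4 ∷ 2 ∷ 2 ∷ 3 ∷ []) ∷
  colouring (1 ∷ 2 ∷ 1 ∷ 0 ∷ 0 ∷ []) (0 ∷ 1 ∷ 0 ∷ 3 ∷ 0 ∷ []) (0 ∷ 0 ∷ 3 ∷ 2 ∷ 4 ∷ []) (3 ∷ 4 ∷ 2 ∷ 1 ∷ 2 ∷ []) (0 ∷ 0 ∷ 4 ∷ 1 ∷ 1 ∷ []) ∷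
  colouring (3 ∷ 0 ∷ 0 ∷ 2 ∷ 1 ∷ []) (0 ∷ 0 ∷ 0 ∷ 0 ∷ 1 ∷ []) (2 ∷ 4 ∷ 1 ∷ 0 ∷ 0 ∷ []) (2 ∷ 1 ∷ 2 ∷ 4 ∷ 3 ∷ []) (1 ∷ 1 ∷ 3 ∷ 0 ∷ 4 ∷ []) ∷
  colouring (0 ∷ 1 ∷ 0 ∷ 3 ∷ 0 ∷ []) (0 ∷ 0 ∷ 1 ∷ 2 ∷ 1 ∷ []) (3 ∷ 4 ∷ 1 ∷ 2 ∷ 1 ∷ []) (1 ∷ 3 ∷ 0 ∷ 0 ∷ 4 ∷ []) (2 ∷ 0 ∷ 2 ∷ 0 ∷ 4 ∷ []) ∷
  colouring (1 ∷ 0 ∷ 0 ∷ 1 ∷ 2 ∷ []) (0 ∷ 0 ∷ 0 ∷ 0 ∷ 0 ∷ []) (3 ∷ 1 ∷ 4 ∷ 0 ∷ 0 ∷ []) (3 ∷ 1 ∷ 2 ∷ 1 ∷ 4 ∷ []) (4 ∷ 2 ∷ 2 ∷ 3 ∷ 1 ∷ []) ∷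
  colouring (0 ∷ 0 ∷ 1 ∷ 0 ∷ 0 ∷ []) (3 ∷ 0 ∷ 1 ∷ 2 ∷ 1 ∷ []) (1 ∷ 2 ∷ 4 ∷ 3 ∷ 2 ∷ []) (2 ∷ 4 ∷ 0 ∷ 0 ∷ 0 ∷ []) (4 ∷ 3 ∷ 0 ∷ 1 ∷ 1 ∷ []) ∷
  colouring (0 ∷ 3 ∷ 1 ∷ 2 ∷ 1 ∷ []) (0 ∷ 0 ∷ 0 ∷ 0 ∷ 0 ∷ []) (1 ∷ 0 ∷ 0 ∷ 0 ∷ 4 ∷ []) (3 ∷ 4 ∷ 1 ∷ 2 ∷ 1 ∷ []) (2 ∷ 2 ∷ 4 ∷ 1 ∷ 3 ∷ []) ∷
  colouring (0 ∷ 0 ∷ 1 ∷ 0 ∷ 0 ∷ []) (2 ∷ 0 ∷ 0 ∷ 0 ∷ 1 ∷ []) (1 ∷ 4 ∷ 3 ∷ 1 ∷ 2 ∷ []) (1 ∷ 4 ∷ 1 ∷ 3 ∷ 0 ∷ []) (3 ∷ 2 ∷ 0 ∷ 2 ∷ 4 ∷ []) ∷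
  colouring (3 ∷ 0 ∷ 0 ∷ 0 ∷ 0 ∷ []) (0 ∷ 1 ∷ 2 ∷ 1 ∷ 0 ∷ []) (1 ∷ 4 ∷ 3 ∷ 1 ∷ 2 ∷ []) (4 ∷ 0 ∷ 0 ∷ 3 ∷ 1 ∷ []) (0 ∷ 2 ∷ 1 ∷ 2 ∷ 4 ∷ []) ∷
  colouring (1 ∷ 3 ∷ 0 ∷ 0 ∷ 0 ∷ []) (0 ∷ 0 ∷ 2 ∷ 1 ∷ 0 ∷ []) (0 ∷ 2 ∷ 1 ∷ 2 ∷ 4 ∷ []) (4 ∷ 1 ∷ 0 ∷ 3 ∷ 2 ∷ []) (0 ∷ 1 ∷ 4 ∷ 3 ∷ 1 ∷ []) ∷
  []

Injective₅ : Vec (Fin 5) 5 → Set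
Injective₅ t = ∀ i j → lookup t i ≡ lookup t j → i ≡ j

injective₅? : ∀ t → Dec (Injective₅ t)
injective₅? t = Finₚ.all? λ i → Finₚ.all? λ j → (lookup t i Finₚ.≟ lookup t j) →-dec (i Finₚ.≟ j)

allVec : ∀ {n k} → (Vec (Fin n) k → Bool) → Bool
allVec {k = zero} p = p []
allVec {n} {suc k} p = all (λ x → allVec (λ t → p (x ∷ t))) (allFin n)

allVec-sound : ∀ {n k} (p : Vec (Fin n) k → Bool) → T (allVec p) → ∀ t → T (p t)
allVec-sound p h [] = h
allVec-sound {n} p h (x ∷ t) = allVec-sound (λ t → p (x ∷ t)) (All.lookup all-x (∈-allFin x)) t
  where
  all-x = all⁺ (λ y → allVec (λ t → p (y ∷ t))) (allFin n) h

passes : Vec (Fin 5) 5 → (Vertex₅ ⊎ Edge₅ → Fin 5) → Bool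
passes t c = PackingCheck.checked _≟S_ (Prism₅.nbrs (lookup t)) c points₅

opaque
  unfolding PackingCheck.checked
  all-admit : T (allVec λ t → not ⌊ injective₅? t ⌋ ∨ any (passes t) candidates)
  all-admit = _

injective⇒passes : ∀ t → Injective₅ t → ∃ λ c → T (passes t c)
injective⇒passes t inj = satisfied (any⁻ (passes t) candidates (resolve {⌊ injective₅? t ⌋} {any (passes t) candidates}
  (allVec-sound (λ t → not ⌊ injective₅? t ⌋ ∨ any (passes t) candidates) all-admit t)
  (fromWitness {a? = injective₅? t} inj)))
  where
  resolve : ∀ {b x} → T (not b ∨ x) → T b → T x
  resolve {true} h _ = h

prism₅ : (σ : Permutation′ 5) → PackChromLe (SAdj (GenPrism 5 σ)) 5
prism₅ σ = c , PackingCheck.checked⇒packing _≟S_ (Prism₅.nbrs f) c nbrs-complete points₅-complete passes-c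
  where
  t : Vec (Fin 5) 5
  t = tabulate (σ ⟨$⟩ʳ_)
  f = lookup t
  f≗σ : ∀ i → f i ≡ σ ⟨$⟩ʳ i
  f≗σ = lookup∘tabulate (σ ⟨$⟩ʳ_)
  injective : Injective₅ t
  injective i j eq = Injection.injective (↔⇒↣ σ) (trans (sym (f≗σ i)) (trans eq (f≗σ j)))
  nbrs-complete : ∀ {a b} → SAdj (GenPrism 5 σ) a b → b ∈ Prism₅.nbrs f a
  nbrs-complete r = Prism₅.nbrs-complete f (GenPrism⊆PrismOn f≗σ r)
  c = proj₁ (injective⇒passes t injective)
  passes-c = proj₂ (injective⇒passes t injective)

e₄ : Periodic
e₄ = periodic opp four [] (five ∷ opp ∷ four ∷ five ∷ opp ∷ four ∷ []) (opp ∷ five ∷ []) (opp , four)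

e₆ : Periodic
e₆ = periodic opp four [] (five ∷ opp ∷ four ∷ five ∷ opp ∷ four ∷ [])
              (five ∷ opp ∷ four ∷ five ∷ []) (opp , four)

e₈ : Periodic
e₈ = periodic opp four [] (five ∷ opp ∷ four ∷ five ∷ opp ∷ four ∷ [])
              (opp ∷ five ∷ opp ∷ four ∷ opp ∷ five ∷ []) (opp , four)

o₇ : Triple
o₇ = triple
  (periodic anchor opp (four ∷ five ∷ []) (opp ∷ four ∷ five ∷ opp ∷ four ∷ five ∷ [])
             (opp ∷ four ∷ five ∷ []) (four , five))
  (periodic anchor opp (five ∷ opp ∷ []) (four ∷ five ∷ opp ∷ four ∷ five ∷ opp ∷ [])
             (four ∷ opp ∷ five ∷ []) (five , opp))
  (periodic anchor five (opp ∷ four ∷ []) (five ∷ opp ∷ four ∷ five ∷ opp ∷ four ∷ [])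
             (opp ∷ five ∷ opp ∷ []) (opp , four))

o₉ : Triple
o₉ = triple
  (periodic anchor opp (five ∷ opp ∷ []) (four ∷ five ∷ opp ∷ four ∷ five ∷ opp ∷ [])
             (four ∷ five ∷ opp ∷ four ∷ five ∷ []) (five , opp))
  (periodic anchor opp (five ∷ four ∷ []) (opp ∷ five ∷ four ∷ opp ∷ five ∷ four ∷ [])
             (opp ∷ five ∷ four ∷ opp ∷ five ∷ []) (five , four))
  (periodic anchor five (four ∷ opp ∷ []) (five ∷ four ∷ opp ∷ five ∷ four ∷ opp ∷ [])
             (five ∷ four ∷ opp ∷ five ∷ opp ∷ []) (four , opp))

o₁₁ : Triple
o₁₁ = triple
  (periodic anchor opp (four ∷ opp ∷ []) (five ∷ four ∷ opp ∷ five ∷ four ∷ opp ∷ [])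
             (five ∷ opp ∷ four ∷ five ∷ opp ∷ four ∷ five ∷ []) (four , opp))
  (periodic anchor opp (five ∷ opp ∷ []) (four ∷ five ∷ opp ∷ four ∷ five ∷ opp ∷ [])
             (four ∷ opp ∷ five ∷ opp ∷ four ∷ opp ∷ five ∷ []) (five , opp))
  (periodic anchor five (opp ∷ four ∷ []) (five ∷ opp ∷ four ∷ five ∷ opp ∷ four ∷ [])
             (opp ∷ five ∷ opp ∷ four ∷ opp ∷ five ∷ opp ∷ []) (opp , four))

o₃ : Triple
o₃ = triple w w w
  where w = periodic anchor five (opp ∷ []) [] [] (five , opp)

data Size : ℕ → Set where
  n₃ : Size 3
  n₅ : Size 5
  n₄ : ∀ k → Size (4 + k * 6)
  n₆ : ∀ k → Size (6 + k * 6)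
  n₇ : ∀ k → Size (7 + k * 6)
  n₈ : ∀ k → Size (8 + k * 6)
  n₉ : ∀ k → Size (9 + k * 6)
  n₁₁ : ∀ k → Size (11 + k * 6)

sizeView : ∀ n → 3 ≤ n → Size n
sizeView 1 (s≤s ())
sizeView 2 (s≤s (s≤s ()))
sizeView 3 _ = n₃
sizeView 4 _ = n₄ 0
sizeView 5 _ = n₅
sizeView 6 _ = n₆ 0
sizeView 7 _ = n₇ 0
sizeView 8 _ = n₈ 0
sizeView (suc (suc (suc (suc (suc (suc n@(suc (suc (suc _))))))))) _ with sizeView n (s≤s (s≤s (s≤s z≤n)))
... | n₃ = n₉ 0
... | n₅ = n₁₁ 0
... | n₄ k = n₄ (suc k)
... | n₆ k = n₆ (suc k)
... | n₇ k = n₇ (suc k)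
... | n₈ k = n₈ (suc k)
... | n₉ k = n₉ (suc k)
... | n₁₁ k = n₁₁ (suc k)

mainTheorem6 : (n : ℕ) .{{_ : NonZero n}} → 3 ≤ n → (σ : Permutation′ n) →
    PackChromLe (SAdj (GenPrism n σ)) 5
mainTheorem6 n 3≤n σ with sizeView n 3≤n
... | n₃ = oddPrism 2 σ (s≤s z≤n) (Triple.avoiding o₃ 0)
... | n₅ = prism₅ σ
... | n₄ k = evenPrism (3 + k * 6) σ (s≤s z≤n) (parity-1+6k k) (Periodic.validWord e₄ k) refl
... | n₆ k = evenPrism (5 + k * 6) σ (s≤s z≤n) (parity-1+6k k) (Periodic.validWord e₆ k) refl
... | n₈ k = evenPrism (7 + k * 6) σ (s≤s z≤n) (parity-1+6k k) (Periodic.validWord e₈ k) refl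
... | n₇ k = oddPrism (6 + k * 6) σ (s≤s z≤n) (Triple.avoiding o₇ k)
... | n₉ k = oddPrism (8 + k * 6) σ (s≤s z≤n) (Triple.avoiding o₉ k)
... | n₁₁ k = oddPrism (10 + k * 6) σ (s≤s z≤n) (Triple.avoiding o₁₁ k)
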